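{- Let $G$ be a graph. We have $\varphi_r(G-v)=\varphi_r(G)+\lfloor |V(G)|/2\rfloor-2$ for every vertex $v\in V(G)$ if and only if one of the following holds: (i) $G$ is $P_2$ or $C_3$; (ii) $E(G)=\emptyset$ and $4\le |V(G)|\le 5$; (iii) $4\le |V(G)|\le 5$ and $G$ contains two disjoint edges but does not contain a b-$3$-atom as an induced subgraph.
   Context: A proper $k$-coloring of a graph is a surjective map $c:V\to\{1,\dots,k\}$ with $c(u)\ne c(v)$ for every edge $uv$. In a proper $k$-coloring, a vertex $v$ of color $i$ is a b-vertex if for every $j\ne i$ in $\{1,\dots,k\}$, $v$ has a neighbor of color $j$. A b-$k$-coloring is a proper $k$-coloring in which every color class contains a b-vertex; $\varphi(H)$ is the largest $k$ such that $H$ has a b-$k$-coloring. The b-relaxed number is $\varphi_r(G)=\max\{\varphi(H): H \text{ an induced subgraph of } G\}$. A b-$t$-atom is a graph $A$ whose vertex set can be partitioned into $t$ sets $D_1,\dots,D_t$, where each $D_i$ contains a special vertex $c_i$, such that each $D_i$ is an independent set with $|D_i|\le t$, and for all $i\ne j$, $c_i$ has a neighbor in $D_j$. $G-v$ is the graph obtained by deleting $v$; $P_2$ is the path on two vertices and $C_3$ the triangle. -}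

module Defs where

open import Data.Nat using (ℕ; zero; suc; _≤_; _+_; _/_)
open import Data.Fin using (Fin; punchIn)
open import Data.Fin.Properties using (punchIn-injective)
open import Data.Bool using (Bool; true; false)
open import Data.List using (length; filter)
open import Data.List using () renaming (List to L)
open import Data.Fin using () renaming (_≟_ to _≟F_)
open import Data.List.Base using ()
open import Data.Product using (Σ; ∃; ∃-syntax; _×_; _,_)
open import Data.Sum using (_⊎_)
open import Relation.Nullary using (¬_)
open import Relation.Binary.PropositionalEquality using (_≡_; _≢_; refl)
open import Function.Definitions using (Injective)
import Data.List as List

record Graph (n : ℕ) : Set where
  field
    adj   : Fin n → Fin n → Bool
    adj-sym : ∀ u v → adj u v ≡ adj v u
    irref : ∀ v → adj v v ≡ false
open Graph public

Adj : ∀ {n} → Graph n → Fin n → Fin n → Set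
Adj G u v = adj G u v ≡ true

induce : ∀ {n m} → Graph n → (Fin m → Fin n) → Graph m
induce G f = record
  { adj = λ i j → adj G (f i) (f j)
  ; adj-sym = λ i j → adj-sym G (f i) (f j)
  ; irref = λ i → irref G (f i) }

deleteV : ∀ {m} → Graph (suc m) → Fin (suc m) → Graph m
deleteV G v = induce G (punchIn v)

Surjective : ∀ {n k} → (Fin n → Fin k) → Set
Surjective {n} {k} c = ∀ (i : Fin k) → ∃[ v ] c v ≡ i

IsProperColoring : ∀ {n} (G : Graph n) (k : ℕ) → (Fin n → Fin k) → Set
IsProperColoring G k c = Surjective c × (∀ u v → Adj G u v → c u ≢ c v)

IsBVertex : ∀ {n k} (G : Graph n) → (Fin n → Fin k) → Fin n → Set
IsBVertex {k = k} G c v = ∀ (j : Fin k) → j ≢ c v → ∃[ u ] (Adj G v u × c u ≡ j)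

IsBColoring : ∀ {n} (G : Graph n) (k : ℕ) → (Fin n → Fin k) → Set
IsBColoring G k c =
  IsProperColoring G k c × (∀ (i : Fin k) → ∃[ v ] (c v ≡ i × IsBVertex G c v))

HasBColoring : ∀ {n} → Graph n → ℕ → Set
HasBColoring {n} G k = ∃[ c ] IsBColoring G k c

InducedHasBColoring : ∀ {n} → Graph n → ℕ → Set
InducedHasBColoring {n} G k =
  ∃[ m ] Σ (Fin m → Fin n) λ f → Injective _≡_ _≡_ f × HasBColoring (induce G f) k

-- φ_r(G) = k : k is the maximum of φ(H) over induced subgraphs H,
-- i.e. the largest k such that some induced subgraph has a b-k-colouring.
IsBRelaxed : ∀ {n} → Graph n → ℕ → Set
IsBRelaxed G k =
  InducedHasBColoring G k × (∀ k' → InducedHasBColoring G k' → k' ≤ k)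

count : ∀ {m t} → (Fin m → Fin t) → Fin t → ℕ
count {m} d i = length (filter (λ x → d x ≟F i) (List.allFin m))

IsBAtom : ∀ {m} → Graph m → ℕ → Set
IsBAtom {m} A t =
  Σ (Fin m → Fin t) λ d → Σ (Fin t → Fin m) λ c →
      (∀ i → d (c i) ≡ i)
    × (∀ x y → d x ≡ d y → ¬ Adj A x y)
    × (∀ i → count d i ≤ t)
    × (∀ i j → i ≢ j → ∃[ y ] (d y ≡ j × Adj A (c i) y))

ContainsInducedBAtom : ∀ {n} → Graph n → ℕ → Set
ContainsInducedBAtom {n} G t =
  ∃[ m ] Σ (Fin m → Fin n) λ f → Injective _≡_ _≡_ f × IsBAtom (induce G f) t

Complete : ∀ {n} → Graph n → Set
Complete G = ∀ u v → u ≢ v → Adj G u v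

-- G is (isomorphic to) P₂ = K₂, resp. C₃ = K₃
IsP2 : ∀ {n} → Graph n → Set
IsP2 {n} G = n ≡ 2 × Complete G

IsC3 : ∀ {n} → Graph n → Set
IsC3 {n} G = n ≡ 3 × Complete G

Edgeless : ∀ {n} → Graph n → Set
Edgeless G = ∀ u v → adj G u v ≡ false

TwoDisjointEdges : ∀ {n} → Graph n → Set
TwoDisjointEdges G = ∃[ a ] ∃[ b ] ∃[ c ] ∃[ d ]
  (Adj G a b × Adj G c d × a ≢ c × a ≢ d × b ≢ c × b ≢ d)

-- Write b = φ_r(G), a_v = φ_r(G - v) and n = |V(G)|.  Since a_v ≤ b and ⌊n/2⌋ ≥ 3 for n ≥ 6,
-- only n ≤ 5 can occur.  For n ∈ {2, 3} the identity reads b = a_v + 1, which pushes b up to n,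
-- so G is complete.  For n ∈ {4, 5} it reads a_v = b for every v.  If G has an edge uw but no
-- two disjoint edges, then G - u and G - w still have edges, which forces a triangle uwx
-- containing every edge; so b ≥ 3 while no vertex of G - u has two neighbours there.  A
-- b-3-atom gives b ≥ 3; but b ≥ n - 1 would make every G - v, hence G, complete, and for n = 5,
-- b = 3 puts a triangle into every G - v, which forces a K₄.  Conversely, on at most five
-- vertices every b-3-colouring is a b-3-atom, so in the remaining cases b and all a_v equal 1
-- (no edges) or 2 (two disjoint edges, one of which survives in each G - v).

module Submission where

open import Defs
open import Data.Nat using (ℕ; zero; suc; _≤_; _<_; _+_; _/_; z≤n; s≤s)
import Data.Nat.Properties as ℕ
open import Data.Nat.DivMod using (/-monoˡ-≤)
open import Data.Fin using (Fin; zero; suc; punchIn; punchOut; inject≤; _≟_)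
open import Data.Fin.Properties
  using (0≢1+n; suc-injective; injective⇒≤; punchInᵢ≢i; punchIn-punchOut; punchIn-injective;
         inject≤-injective; any?)
open import Data.List using (List; []; _∷_; length; lookup; tabulate; filter; allFin; _++_)
open import Data.List.Properties using (length-tabulate; length-++)
open import Data.List.Relation.Unary.All as All using (All; []; _∷_)
import Data.List.Relation.Unary.All.Properties as All
open import Data.List.Relation.Unary.AllPairs using (AllPairs; []; _∷_)
import Data.List.Relation.Unary.Any as Any
open import Data.List.Relation.Unary.Unique.Propositional using (Unique)
import Data.List.Relation.Unary.Unique.Propositional.Properties as Unique
open import Data.List.Relation.Binary.Disjoint.Propositional using (Disjoint)
open import Data.List.Membership.Propositional.Properties
  using (∈-lookup; ∈-tabulate⁻; ∈-filter⁻)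
open import Data.Bool using (true; false)
import Data.Bool as Bool
import Data.Bool.Properties as Bool
open import Data.Product using (Σ; ∃-syntax; _×_; _,_; proj₁; proj₂)
open import Data.Sum using (_⊎_; inj₁; inj₂)
open import Data.Empty using (⊥-elim)
open import Relation.Nullary using (¬_; Dec; yes; no)
open import Relation.Nullary.Decidable using (_×-dec_; _⊎-dec_; ¬?; decidable-stable)
open import Relation.Nullary.Negation using (¬¬-map)
open import Relation.Binary.PropositionalEquality using (_≡_; _≢_; refl; sym; trans; cong; subst; subst₂; ≢-sym)
open import Function.Definitions using (Injective)
open import Function.Bundles using (_⇔_; mk⇔)

lookup-injective : ∀ {A : Set} {xs : List A} → Unique xs → Injective _≡_ _≡_ (lookup xs)
lookup-injective {xs = _ ∷ _} _          {zero}  {zero}  _ = refl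
lookup-injective {xs = _ ∷ _} (x∉xs ∷ _) {zero}  {suc j} e = ⊥-elim (All.lookup x∉xs (∈-lookup j) e)
lookup-injective {xs = _ ∷ _} (x∉xs ∷ _) {suc i} {zero}  e = ⊥-elim (All.lookup x∉xs (∈-lookup i) (sym e))
lookup-injective {xs = _ ∷ _} (_ ∷ uniq) {suc i} {suc j} e = cong suc (lookup-injective uniq e)

unique⇒length≤ : ∀ {n} {xs : List (Fin n)} → Unique xs → length xs ≤ n
unique⇒length≤ uniq = injective⇒≤ (lookup-injective uniq)

overfull⇒¬Unique : ∀ {n} {xs : List (Fin n)} → n < length xs → ¬ Unique xs
overfull⇒¬Unique n<len uniq = ℕ.<⇒≱ n<len (unique⇒length≤ uniq)

injective⇒surjective : ∀ {k n} {X : Fin k → Fin n} → Injective _≡_ _≡_ X → n ≤ k →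
  ∀ u → ∃[ i ] X i ≡ u
injective⇒surjective {n = n} {X} X-inj n≤k u with any? (λ i → X i ≟ u)
... | yes hit = hit
... | no miss = ⊥-elim (overfull⇒¬Unique n<len
  (All.tabulate⁺ (λ i e → miss (i , sym e)) ∷ Unique.tabulate⁺ X-inj))
  where
  n<len : n < length (u ∷ tabulate X)
  n<len = s≤s (subst (n ≤_) (sym (length-tabulate X)) n≤k)

third-vertex : ∀ {k} {u w : Fin (suc (suc (suc k)))} → u ≢ w → ∃[ v ] (v ≢ u × v ≢ w)
third-vertex {u = u} u≢w =
  punchIn u (punchIn w′ zero) , punchInᵢ≢i u _ ,
  λ v≡w → punchInᵢ≢i w′ zero (punchIn-injective u _ _ (trans v≡w (sym (punchIn-punchOut u≢w))))
  where
  w′ = punchOut u≢w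

Adj-sym : ∀ {n} (G : Graph n) {u w} → Adj G u w → Adj G w u
Adj-sym G {u} {w} uw = trans (adj-sym G w u) uw

Adj⇒≢ : ∀ {n} (G : Graph n) {u w} → Adj G u w → u ≢ w
Adj⇒≢ G {u} uw refl = Bool.not-¬ uw (irref G u)

¬Adj⇒adj≡false : ∀ {n} (G : Graph n) {u w} → ¬ Adj G u w → adj G u w ≡ false
¬Adj⇒adj≡false G = Bool.¬-not

Adj? : ∀ {n} (G : Graph n) u w → Dec (Adj G u w)
Adj? G u w = adj G u w Bool.≟ true

Edge : ∀ {n} → Graph n → Set
Edge G = ∃[ u ] ∃[ w ] Adj G u w

Edge? : ∀ {n} (G : Graph n) → Dec (Edge G)
Edge? G = any? λ u → any? λ w → Adj? G u w

¬Edge⇒Edgeless : ∀ {n} (G : Graph n) → ¬ Edge G → Edgeless G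
¬Edge⇒Edgeless G ¬edge u w = ¬Adj⇒adj≡false G (λ uw → ¬edge (u , w , uw))

TwoDisjointEdges? : ∀ {n} (G : Graph n) → Dec (TwoDisjointEdges G)
TwoDisjointEdges? G = any? λ a → any? λ b → any? λ c → any? λ d →
  Adj? G a b ×-dec Adj? G c d ×-dec ¬? (a ≟ c) ×-dec ¬? (a ≟ d) ×-dec ¬? (b ≟ c) ×-dec ¬? (b ≟ d)

Cherry : ∀ {n} → Graph n → Set
Cherry G = ∃[ z ] ∃[ p ] ∃[ q ] (Adj G z p × Adj G z q × p ≢ q)

Adj-deleteV⇒Adj : ∀ {m} (G : Graph (suc m)) {v u w} (v≢u : v ≢ u) (v≢w : v ≢ w) →
  Adj (deleteV G v) (punchOut v≢u) (punchOut v≢w) → Adj G u w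
Adj-deleteV⇒Adj G v≢u v≢w = subst₂ (Adj G) (punchIn-punchOut v≢u) (punchIn-punchOut v≢w)

Adj⇒Adj-deleteV : ∀ {m} (G : Graph (suc m)) {v u w} (v≢u : v ≢ u) (v≢w : v ≢ w) →
  Adj G u w → Adj (deleteV G v) (punchOut v≢u) (punchOut v≢w)
Adj⇒Adj-deleteV G v≢u v≢w = subst₂ (Adj G) (sym (punchIn-punchOut v≢u)) (sym (punchIn-punchOut v≢w))

Complete-stable : ∀ {n} (G : Graph n) → ¬ ¬ Complete G → Complete G
Complete-stable G ¬¬complete u w u≢w =
  decidable-stable (Adj? G u w) (¬¬-map (λ complete → complete u w u≢w) ¬¬complete)

deleteV-complete : ∀ {m} (G : Graph (suc m)) v → Complete G → Complete (deleteV G v)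
deleteV-complete G v complete i j i≢j = complete _ _ (λ e → i≢j (punchIn-injective v i j e))

deleteV-complete⇒complete : ∀ {k} (G : Graph (suc (suc (suc k)))) → (∀ v → Complete (deleteV G v)) →
  Complete G
deleteV-complete⇒complete G complete-after u w u≢w with third-vertex u≢w
... | v , v≢u , v≢w = Adj-deleteV⇒Adj G v≢u v≢w (complete-after v _ _ λ e →
  u≢w (trans (sym (punchIn-punchOut v≢u)) (trans (cong (punchIn v) e) (punchIn-punchOut v≢w))))

IsClique : ∀ {n k} → Graph n → (Fin k → Fin n) → Set
IsClique G X = ∀ i j → i ≢ j → Adj G (X i) (X j)

clique⇒injective : ∀ {n k} (G : Graph n) {X : Fin k → Fin n} → IsClique G X → Injective _≡_ _≡_ X
clique⇒injective G cl {i} {j} Xi≡Xj with i ≟ j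
... | yes i≡j = i≡j
... | no i≢j = ⊥-elim (Adj⇒≢ G (cl i j i≢j) Xi≡Xj)

allPairs⇒clique : ∀ {n} (G : Graph n) {xs} → AllPairs (Adj G) xs → IsClique G (lookup xs)
allPairs⇒clique G {_ ∷ _} _          zero    zero    0≢0 = ⊥-elim (0≢0 refl)
allPairs⇒clique G {_ ∷ _} (adjs ∷ _) zero    (suc j) _   = All.lookup adjs (∈-lookup j)
allPairs⇒clique G {_ ∷ _} (adjs ∷ _) (suc i) zero    _   = Adj-sym G (All.lookup adjs (∈-lookup i))
allPairs⇒clique G {_ ∷ _} (_ ∷ cl)   (suc i) (suc j) i≢j =
  allPairs⇒clique G cl i j (λ i≡j → i≢j (cong suc i≡j))

surjective⇒≤ : ∀ {m k} (c : Fin m → Fin k) → Surjective c → k ≤ m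
surjective⇒≤ c c-surj = injective⇒≤ {f = λ i → proj₁ (c-surj i)} λ {i} {j} e →
  trans (sym (proj₂ (c-surj i))) (trans (cong c e) (proj₂ (c-surj j)))

inducedBColoring-≤ : ∀ {n k} (G : Graph n) → InducedHasBColoring G k → k ≤ n
inducedBColoring-≤ G (_ , _ , f-inj , c , (c-surj , _) , _) =
  ℕ.≤-trans (surjective⇒≤ c c-surj) (injective⇒≤ f-inj)

clique⇒inducedBColoring : ∀ {n k} (G : Graph n) {X : Fin k → Fin n} → IsClique G X →
  InducedHasBColoring G k
clique⇒inducedBColoring {k = k} G {X} cl =
  k , X , clique⇒injective G cl , (λ i → i) ,
  ((λ i → i , refl) , λ _ _ → Adj⇒≢ (induce G X)) ,
  λ i → i , refl , λ j j≢i → j , cl i j (λ i≡j → j≢i (sym i≡j)) , refl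

allPairs⇒inducedBColoring : ∀ {n} (G : Graph n) {xs} → AllPairs (Adj G) xs →
  InducedHasBColoring G (length xs)
allPairs⇒inducedBColoring G adjs = clique⇒inducedBColoring G (allPairs⇒clique G adjs)

vertex⇒inducedBColoring : ∀ {n} (G : Graph n) → Fin n → InducedHasBColoring G 1
vertex⇒inducedBColoring G v = allPairs⇒inducedBColoring G {xs = v ∷ []} ([] ∷ [])

edge⇒inducedBColoring : ∀ {n} (G : Graph n) {u w} → Adj G u w → InducedHasBColoring G 2
edge⇒inducedBColoring G uw = allPairs⇒inducedBColoring G ((uw ∷ []) ∷ [] ∷ [])

triangle⇒inducedBColoring : ∀ {n} (G : Graph n) {u w x} → Adj G u w → Adj G u x → Adj G w x →
  InducedHasBColoring G 3
triangle⇒inducedBColoring G uw ux wx = allPairs⇒inducedBColoring G ((uw ∷ ux ∷ []) ∷ (wx ∷ []) ∷ [] ∷ [])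

clique₄⇒inducedBColoring : ∀ {n} (G : Graph n) {a b c d} →
  Adj G a b → Adj G a c → Adj G a d → Adj G b c → Adj G b d → Adj G c d → InducedHasBColoring G 4
clique₄⇒inducedBColoring G ab ac ad bc bd cd =
  allPairs⇒inducedBColoring G ((ab ∷ ac ∷ ad ∷ []) ∷ (bc ∷ bd ∷ []) ∷ (cd ∷ []) ∷ [] ∷ [])

complete⇒inducedBColoring-full : ∀ {n} (G : Graph n) → Complete G → InducedHasBColoring G n
complete⇒inducedBColoring-full G = clique⇒inducedBColoring G

inducedBColoring-induce : ∀ {n m k} (G : Graph n) {g : Fin m → Fin n} → Injective _≡_ _≡_ g →
  InducedHasBColoring (induce G g) k → InducedHasBColoring G k
inducedBColoring-induce G g-inj (l , f , f-inj , coloring) =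
  l , _ , (λ e → f-inj (g-inj e)) , coloring

inducedBColoring-deleteV : ∀ {m k} (G : Graph (suc m)) v →
  InducedHasBColoring (deleteV G v) k → InducedHasBColoring G k
inducedBColoring-deleteV G v = inducedBColoring-induce G (punchIn-injective v _ _)

bVertex-neighbour : ∀ {n k} (H : Graph n) {c : Fin n → Fin k} {x i} →
  IsBVertex H c x → c x ≡ i → ∀ j → j ≢ i → ∃[ y ] (Adj H x y × c y ≡ j)
bVertex-neighbour H x-b cx≡i _ j≢i = x-b _ (λ j≡cx → j≢i (trans j≡cx cx≡i))

inducedBColoring⇒edge : ∀ {n k} (G : Graph n) → InducedHasBColoring G k → 2 ≤ k → Edge G
inducedBColoring⇒edge G (_ , f , _ , c , _ , b-vertices) (s≤s (s≤s _)) with b-vertices zero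
... | x , cx , x-b with bVertex-neighbour (induce G f) x-b cx (suc zero) (λ ())
...   | y , xy , _ = f x , f y , xy

inducedBColoring⇒cherry : ∀ {n k} (G : Graph n) → InducedHasBColoring G k → 3 ≤ k → Cherry G
inducedBColoring⇒cherry G (_ , f , f-inj , c , _ , b-vertices) (s≤s (s≤s (s≤s _))) with b-vertices zero
... | x , cx , x-b
    with bVertex-neighbour (induce G f) x-b cx (suc zero) (λ ())
       | bVertex-neighbour (induce G f) x-b cx (suc (suc zero)) (λ ())
...   | y , xy , cy | z , xz , cz =
  f x , f y , f z , xy , xz ,
  λ fy≡fz → 0≢1+n (suc-injective (trans (sym cy) (trans (cong c (f-inj fy≡fz)) cz)))

edgeless⇒inducedBColoring-≤1 : ∀ {n} (G : Graph n) → Edgeless G → ∀ k → InducedHasBColoring G k → k ≤ 1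
edgeless⇒inducedBColoring-≤1 G _        zero          _ = z≤n
edgeless⇒inducedBColoring-≤1 G _        (suc zero)    _ = ℕ.≤-refl
edgeless⇒inducedBColoring-≤1 G edgeless (suc (suc k)) φ with inducedBColoring⇒edge G φ (s≤s (s≤s z≤n))
... | u , w , uw = ⊥-elim (Bool.not-¬ uw (edgeless u w))

bColoring-dense⇒clique : ∀ {n k} (H : Graph n) {c : Fin n → Fin k} → IsBColoring H k c → n ≤ suc k →
  Σ (Fin k → Fin n) (IsClique H)
bColoring-dense⇒clique {n} {k} H {c} (_ , b-vertices) n≤1+k = x , x-clique
  where
  x : Fin k → Fin n
  x i = proj₁ (b-vertices i)
  cx : ∀ i → c (x i) ≡ i
  cx i = proj₁ (proj₂ (b-vertices i))
  x-inj : Injective _≡_ _≡_ x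
  x-inj {i} {j} e = trans (sym (cx i)) (trans (cong c e) (cx j))
  avoids-b-vertices : ∀ {y j} → c y ≡ j → y ≢ x j → All (y ≢_) (tabulate x)
  avoids-b-vertices cy y≢xj = All.tabulate⁺ λ l y≡xl →
    y≢xj (trans y≡xl (cong x (trans (sym (cx l)) (trans (cong c (sym y≡xl)) cy))))
  too-many : ∀ y y' → n < length (y ∷ y' ∷ tabulate x)
  too-many _ _ = s≤s (subst (n ≤_) (sym (cong suc (length-tabulate x))) n≤1+k)
  -- If x i and x j were not adjacent, their neighbours of colours j and i would be two
  -- further vertices besides the k b-vertices.
  x-clique : IsClique H x
  x-clique i j i≢j
    with bVertex-neighbour H (proj₂ (proj₂ (b-vertices i))) (cx i) j (≢-sym i≢j)
       | bVertex-neighbour H (proj₂ (proj₂ (b-vertices j))) (cx j) i i≢j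
  ... | y , xi-y , cy | y' , xj-y' , cy' with y ≟ x j | y' ≟ x i
  ...   | yes refl | _        = xi-y
  ...   | no _     | yes refl = Adj-sym H xj-y'
  ...   | no y≢xj  | no y'≢xi = ⊥-elim (overfull⇒¬Unique (too-many y y')
          ((y≢y' ∷ avoids-b-vertices cy y≢xj) ∷ avoids-b-vertices cy' y'≢xi ∷ Unique.tabulate⁺ x-inj))
    where
    y≢y' : y ≢ y'
    y≢y' y≡y' = i≢j (trans (sym cy') (trans (cong c (sym y≡y')) cy))

inducedBColoring-dense⇒clique : ∀ {n k} (G : Graph n) → InducedHasBColoring G k → n ≤ suc k →
  Σ (Fin k → Fin n) (IsClique G)
inducedBColoring-dense⇒clique G (_ , f , f-inj , _ , coloring) n≤1+k
  with bColoring-dense⇒clique (induce G f) coloring (ℕ.≤-trans (injective⇒≤ f-inj) n≤1+k)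
... | X , X-clique = (λ i → f (X i)) , X-clique

inducedBColoring-full⇒complete : ∀ {n} (G : Graph n) → InducedHasBColoring G n → Complete G
inducedBColoring-full⇒complete G φ u w u≢w
  with inducedBColoring-dense⇒clique G φ (ℕ.n≤1+n _)
... | X , X-clique
  with injective⇒surjective (clique⇒injective G X-clique) ℕ.≤-refl u
     | injective⇒surjective (clique⇒injective G X-clique) ℕ.≤-refl w
... | i , refl | j , refl = X-clique i j (λ i≡j → u≢w (cong X i≡j))

inducedBColoring-dense-≤ : ∀ {n k j} (G : Graph n) → InducedHasBColoring G k → n ≤ suc k → j ≤ k →
  InducedHasBColoring G j
inducedBColoring-dense-≤ G φ n≤1+k j≤k with inducedBColoring-dense⇒clique G φ n≤1+k
... | X , X-clique = clique⇒inducedBColoring G {X = λ i → X (inject≤ i j≤k)}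
  λ i i' i≢i' → X-clique _ _ (λ e → i≢i' (inject≤-injective j≤k j≤k i i' e))

-- The representatives of the other s colours are distinct from each other and from class i.
colourClass-bound : ∀ {m s} (d : Fin m → Fin (suc s)) (r : Fin (suc s) → Fin m) →
  (∀ i → d (r i) ≡ i) → ∀ i → s + count d i ≤ m
colourClass-bound {m} d r dr i = subst (_≤ m) length-others++class (unique⇒length≤ unique-others++class)
  where
  others = tabulate (λ l → r (punchIn i l))
  class  = filter (λ x → d x ≟ i) (allFin m)
  others-inj : Injective _≡_ _≡_ (λ l → r (punchIn i l))
  others-inj e = punchIn-injective i _ _ (trans (sym (dr _)) (trans (cong d e) (dr _)))
  disjoint : Disjoint others class
  disjoint (v∈others , v∈class)
    with ∈-tabulate⁻ v∈others | ∈-filter⁻ (λ x → d x ≟ i) {xs = allFin m} v∈class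
  ... | l , refl | _ , dv≡i = punchInᵢ≢i i l (trans (sym (dr _)) dv≡i)
  unique-others++class : Unique (others ++ class)
  unique-others++class =
    Unique.++⁺ (Unique.tabulate⁺ others-inj) (Unique.filter⁺ _ (Unique.allFin⁺ m)) disjoint
  length-others++class : length (others ++ class) ≡ _ + count d i
  length-others++class = trans (length-++ others) (cong (_+ count d i) (length-tabulate _))

inducedBColoring⇒bAtom : ∀ {n s} (G : Graph n) → InducedHasBColoring G (suc s) → n ≤ s + suc s →
  ContainsInducedBAtom G (suc s)
inducedBColoring⇒bAtom {s = s} G (m , f , f-inj , c , (_ , proper) , b-vertices) n≤2s+1 =
  m , f , f-inj , c , r , cr , (λ x y cx≡cy xy → proper x y xy cx≡cy) , class-≤ , neighbours
  where
  r : Fin (suc s) → Fin m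
  r i = proj₁ (b-vertices i)
  cr : ∀ i → c (r i) ≡ i
  cr i = proj₁ (proj₂ (b-vertices i))
  class-≤ : ∀ i → count c i ≤ suc s
  class-≤ i = ℕ.+-cancelˡ-≤ s _ _
    (ℕ.≤-trans (colourClass-bound c r cr i) (ℕ.≤-trans (injective⇒≤ f-inj) n≤2s+1))
  neighbours : ∀ i j → i ≢ j → ∃[ y ] (c y ≡ j × Adj (induce G f) (r i) y)
  neighbours i j i≢j with bVertex-neighbour (induce G f) (proj₂ (proj₂ (b-vertices i))) (cr i) j (≢-sym i≢j)
  ... | y , ry , cy = y , cy , ry

bAtom⇒inducedBColoring : ∀ {n t} (G : Graph n) → ContainsInducedBAtom G t → InducedHasBColoring G t
bAtom⇒inducedBColoring G (m , f , f-inj , d , r , dr , independent , _ , neighbours) =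
  m , f , f-inj , d , ((λ i → r i , dr i) , λ x y xy dx≡dy → independent x y dx≡dy xy) ,
  λ i → r i , dr i , λ j j≢dri → b-neighbour i j (λ i≡j → j≢dri (trans (sym i≡j) (sym (dr i))))
  where
  b-neighbour : ∀ i j → i ≢ j → ∃[ y ] (Adj (induce G f) (r i) y × d y ≡ j)
  b-neighbour i j i≢j with neighbours i j i≢j
  ... | y , dy , ry = y , ry , dy

¬bAtom⇒inducedBColoring-≤2 : ∀ {n} (G : Graph n) → n ≤ 5 → ¬ ContainsInducedBAtom G 3 →
  ∀ k → InducedHasBColoring G k → k ≤ 2
¬bAtom⇒inducedBColoring-≤2 G _    _     0 _ = z≤n
¬bAtom⇒inducedBColoring-≤2 G _    _     1 _ = s≤s z≤n
¬bAtom⇒inducedBColoring-≤2 G _    _     2 _ = ℕ.≤-refl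
¬bAtom⇒inducedBColoring-≤2 G n≤5 ¬atom 3 φ = ⊥-elim (¬atom (inducedBColoring⇒bAtom G φ n≤5))
¬bAtom⇒inducedBColoring-≤2 G n≤5 ¬atom (suc (suc (suc (suc k)))) φ = ⊥-elim (¬atom
  (inducedBColoring⇒bAtom G
    (inducedBColoring-dense-≤ G φ (ℕ.≤-trans n≤5 (ℕ.m≤m+n 5 k)) (s≤s (s≤s (s≤s z≤n)))) n≤5))

¬¬-maximum : (Q : ℕ → Set) → Q 0 → ∀ N → (∀ k → Q k → k ≤ N) →
  ¬ ¬ (∃[ b ] (Q b × (∀ k → Q k → k ≤ b)))
¬¬-maximum Q q₀ zero    ≤0   no-max = no-max (0 , q₀ , ≤0)
¬¬-maximum Q q₀ (suc N) ≤1+N no-max = ¬¬Q[1+N] (λ q → no-max (suc N , q , ≤1+N))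
  where
  ¬¬Q[1+N] : ¬ ¬ Q (suc N)
  ¬¬Q[1+N] ¬q = ¬¬-maximum Q q₀ N
    (λ k qk → ℕ.≤-pred (ℕ.≤∧≢⇒< (≤1+N k qk) (λ { refl → ¬q qk }))) no-max

-- φ_r is a maximum over a family that is not decided here, so it exists only up to double
-- negation; every argument using it proves ⊥ or a decidable statement.
¬¬-bRelaxed : ∀ {n} (G : Graph n) → ¬ ¬ (∃[ b ] IsBRelaxed G b)
¬¬-bRelaxed G = ¬¬-maximum (InducedHasBColoring G) (allPairs⇒inducedBColoring G []) _
  (λ _ → inducedBColoring-≤ G)

bRelaxed-≡ : ∀ {n b k} (G : Graph n) → IsBRelaxed G b → InducedHasBColoring G k →
  (∀ j → InducedHasBColoring G j → j ≤ k) → b ≡ k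
bRelaxed-≡ G (φb , b-max) φk k-max = ℕ.≤-antisym (k-max _ φb) (b-max _ φk)

bRelaxed-≤ : ∀ {n b} (G : Graph n) → IsBRelaxed G b → b ≤ n
bRelaxed-≤ G (φb , _) = inducedBColoring-≤ G φb

bRelaxed-full : ∀ {n} (G : Graph n) → InducedHasBColoring G n → IsBRelaxed G n
bRelaxed-full G φ = φ , λ _ → inducedBColoring-≤ G

bRelaxed-deleteV-≤ : ∀ {m a b} (G : Graph (suc m)) v → IsBRelaxed (deleteV G v) a → IsBRelaxed G b → a ≤ b
bRelaxed-deleteV-≤ G v (φa , _) (_ , b-max) = b-max _ (inducedBColoring-deleteV G v φa)

complete⇒bRelaxed≡ : ∀ {n b} (G : Graph n) → Complete G → IsBRelaxed G b → b ≡ n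
complete⇒bRelaxed≡ G complete Rb =
  bRelaxed-≡ G Rb (complete⇒inducedBColoring-full G complete) (λ _ → inducedBColoring-≤ G)

edgeless⇒bRelaxed≡1 : ∀ {n b} (G : Graph n) → Edgeless G → Fin n → IsBRelaxed G b → b ≡ 1
edgeless⇒bRelaxed≡1 G edgeless v Rb =
  bRelaxed-≡ G Rb (vertex⇒inducedBColoring G v) (edgeless⇒inducedBColoring-≤1 G edgeless)

bRelaxed-≥⇒complete : ∀ {n b} (G : Graph n) → IsBRelaxed G b → n ≤ b → Complete G
bRelaxed-≥⇒complete G Rb n≤b = inducedBColoring-full⇒complete G
  (subst (InducedHasBColoring G) (ℕ.≤-antisym (bRelaxed-≤ G Rb) n≤b) (proj₁ Rb))

bRelaxed-≤2⇒¬bAtom : ∀ {n} (G : Graph n) → (∀ {b} → IsBRelaxed G b → b ≤ 2) → ¬ ContainsInducedBAtom G 3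
bRelaxed-≤2⇒¬bAtom G ≤2 atom = ¬¬-bRelaxed G λ { (b , Rb) →
  ℕ.n≮n 2 (ℕ.≤-trans (proj₂ Rb 3 (bAtom⇒inducedBColoring G atom)) (≤2 Rb)) }

DeletionInvariant : ∀ {m} → Graph (suc m) → Set
DeletionInvariant G = ∀ v a b → IsBRelaxed (deleteV G v) a → IsBRelaxed G b → a ≡ b

invariant-deleteV : ∀ {m b} (G : Graph (suc m)) → DeletionInvariant G → IsBRelaxed G b →
  ∀ v → ¬ ¬ InducedHasBColoring (deleteV G v) b
invariant-deleteV G invariant Rb v = ¬¬-map
  (λ { (a , Ra) → subst (InducedHasBColoring (deleteV G v)) (invariant v a _ Ra Rb) (proj₁ Ra) })
  (¬¬-bRelaxed (deleteV G v))

-- b = n is impossible since every G - v has fewer vertices; b = n - 1 would make every G - v,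
-- hence G, complete.
invariant⇒bRelaxed-≤ : ∀ {k b} (G : Graph (suc (suc (suc k)))) → DeletionInvariant G → IsBRelaxed G b →
  b ≤ suc k
invariant⇒bRelaxed-≤ G invariant Rb with ℕ.m≤n⇒m<n∨m≡n (bRelaxed-≤ G Rb)
... | inj₂ refl = ⊥-elim (invariant-deleteV G invariant Rb zero λ φ →
  ℕ.n≮n _ (inducedBColoring-≤ (deleteV G zero) φ))
... | inj₁ (s≤s b≤2+k) with ℕ.m≤n⇒m<n∨m≡n b≤2+k
...   | inj₁ (s≤s b≤1+k) = b≤1+k
...   | inj₂ refl = ⊥-elim (ℕ.n≮n _ (proj₂ Rb _ (complete⇒inducedBColoring-full G complete)))
  where
  complete : Complete G
  complete = deleteV-complete⇒complete G λ v → Complete-stable (deleteV G v)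
    (¬¬-map (inducedBColoring-full⇒complete (deleteV G v)) (invariant-deleteV G invariant Rb v))

module _ {m} (G : Graph (suc m)) (no-disjoint-edges : ¬ TwoDisjointEdges G) where

  edges-meet : ∀ {p q s t} → Adj G p q → Adj G s t → p ≡ s ⊎ p ≡ t ⊎ q ≡ s ⊎ q ≡ t
  edges-meet {p} {q} {s} {t} pq st with p ≟ s | p ≟ t | q ≟ s | q ≟ t
  ... | yes p≡s | _        | _        | _        = inj₁ p≡s
  ... | no _    | yes p≡t  | _        | _        = inj₂ (inj₁ p≡t)
  ... | no _    | no _     | yes q≡s  | _        = inj₂ (inj₂ (inj₁ q≡s))
  ... | no _    | no _     | no _     | yes q≡t  = inj₂ (inj₂ (inj₂ q≡t))
  ... | no p≢s  | no p≢t   | no q≢s   | no q≢t   =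
    ⊥-elim (no-disjoint-edges (p , q , s , t , pq , st , p≢s , p≢t , q≢s , q≢t))

  edge-avoiding-through : ∀ {u w p q} → Adj G u w → Adj G p q → p ≢ u → q ≢ u → p ≡ w ⊎ q ≡ w
  edge-avoiding-through uw pq p≢u q≢u with edges-meet pq uw
  ... | inj₁ p≡u                 = ⊥-elim (p≢u p≡u)
  ... | inj₂ (inj₁ p≡w)          = inj₁ p≡w
  ... | inj₂ (inj₂ (inj₁ q≡u))   = ⊥-elim (q≢u q≡u)
  ... | inj₂ (inj₂ (inj₂ q≡w))   = inj₂ q≡w

  deleteV-edge⇒neighbour : ∀ {u w} → Adj G u w → Edge (deleteV G u) → ∃[ x ] (Adj G w x × x ≢ u)
  deleteV-edge⇒neighbour {u} uw (p , q , pq)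
    with edge-avoiding-through uw pq (punchInᵢ≢i u p) (punchInᵢ≢i u q)
  ... | inj₁ refl = punchIn u q , pq , punchInᵢ≢i u q
  ... | inj₂ refl = punchIn u p , Adj-sym G pq , punchInᵢ≢i u p

  deleteV-edges⇒triangle : ∀ {u w} → Adj G u w → Edge (deleteV G u) → Edge (deleteV G w) →
    ∃[ x ] (Adj G u x × Adj G w x)
  deleteV-edges⇒triangle uw Eu Ew
    with deleteV-edge⇒neighbour uw Eu | deleteV-edge⇒neighbour (Adj-sym G uw) Ew
  ... | x , wx , x≢u | y , uy , y≢w with edges-meet wx uy
  ... | inj₁ w≡u               = ⊥-elim (Adj⇒≢ G uw (sym w≡u))
  ... | inj₂ (inj₁ w≡y)        = ⊥-elim (y≢w (sym w≡y))
  ... | inj₂ (inj₂ (inj₁ x≡u)) = ⊥-elim (x≢u x≡u)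
  ... | inj₂ (inj₂ (inj₂ refl)) = x , uy , wx

  -- Every edge of G - u meets both uw and ux, so it is the edge wx.
  triangle⇒deleteV-¬cherry : ∀ {u w x} → Adj G u w → Adj G u x → Adj G w x → ¬ Cherry (deleteV G u)
  triangle⇒deleteV-¬cherry {u} {w} {x} uw ux wx (z , p , q , zp , zq , p≢q) with punchIn u z ≟ w
  ... | yes refl = p≢q (punchIn-injective u p q (trans (ends-at-x zp) (sym (ends-at-x zq))))
    where
    ends-at-x : ∀ {r} → Adj G (punchIn u z) (punchIn u r) → punchIn u r ≡ x
    ends-at-x {r} zr with edge-avoiding-through ux zr (punchInᵢ≢i u z) (punchInᵢ≢i u r)
    ... | inj₁ z≡x = ⊥-elim (Adj⇒≢ G wx z≡x)
    ... | inj₂ r≡x = r≡x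
  ... | no z≢w = p≢q (punchIn-injective u p q (trans (ends-at-w zp) (sym (ends-at-w zq))))
    where
    ends-at-w : ∀ {r} → Adj G (punchIn u z) (punchIn u r) → punchIn u r ≡ w
    ends-at-w {r} zr with edge-avoiding-through uw zr (punchInᵢ≢i u z) (punchInᵢ≢i u r)
    ... | inj₁ z≡w = ⊥-elim (z≢w z≡w)
    ... | inj₂ r≡w = r≡w

  edge⇒¬invariant : ∀ {u w} → Adj G u w → ¬ DeletionInvariant G
  edge⇒¬invariant {u} {w} uw invariant = ¬¬-bRelaxed G λ { (b , Rb) →
    let 2≤b   = proj₂ Rb 2 (edge⇒inducedBColoring G uw)
        after = invariant-deleteV G invariant Rb
    in after u λ φu → after w λ φw →
    let (x , ux , wx) = deleteV-edges⇒triangle uw (inducedBColoring⇒edge (deleteV G u) φu 2≤b)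
                                                  (inducedBColoring⇒edge (deleteV G w) φw 2≤b)
        3≤b           = proj₂ Rb 3 (triangle⇒inducedBColoring G uw ux wx)
    in triangle⇒deleteV-¬cherry uw ux wx (inducedBColoring⇒cherry (deleteV G u) φu 3≤b) }

Dominating : ∀ {n} → Graph n → Fin n → Set
Dominating G y = ∀ p → p ≢ y → Adj G y p

distinct-neighbours⇒dominating : ∀ {n} (G : Graph (suc n)) {y} {xs : List (Fin (suc n))} →
  Unique xs → length xs ≡ n → All (Adj G y) xs → Dominating G y
distinct-neighbours⇒dominating G {xs = xs} unique-xs |xs|≡n y~xs p p≢y with Any.any? (p ≟_) xs
... | yes p∈xs = All.lookup y~xs p∈xs
... | no p∉xs = ⊥-elim (overfull⇒¬Unique (s≤s (s≤s (ℕ.≤-reflexive (sym |xs|≡n))))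
  ((p≢y ∷ All.¬Any⇒All¬ xs p∉xs) ∷ All.map (Adj⇒≢ G) y~xs ∷ unique-xs))

TriangleAvoiding : ∀ {n} → Graph n → Fin n → Set
TriangleAvoiding G v = ∃[ p ] ∃[ q ] ∃[ r ] ((p ≢ v × q ≢ v × r ≢ v) × Adj G p q × Adj G p r × Adj G q r)

TriangleAvoiding? : ∀ {n} (G : Graph n) v → Dec (TriangleAvoiding G v)
TriangleAvoiding? G v = any? λ p → any? λ q → any? λ r →
  (¬? (p ≟ v) ×-dec ¬? (q ≟ v) ×-dec ¬? (r ≟ v)) ×-dec Adj? G p q ×-dec Adj? G p r ×-dec Adj? G q r

dominating⇒clique₄ : ∀ {n} (G : Graph n) {y} → Dominating G y → TriangleAvoiding G y →
  InducedHasBColoring G 4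
dominating⇒clique₄ G dominating (p , q , r , (p≢y , q≢y , r≢y) , pq , pr , qr) =
  clique₄⇒inducedBColoring G (dominating p p≢y) (dominating q q≢y) (dominating r r≢y) pq pr qr

deleteV-inducedBColoring⇒triangle : ∀ {m k} (G : Graph (suc m)) v →
  InducedHasBColoring (deleteV G v) k → m ≤ suc k → 3 ≤ k → TriangleAvoiding G v
deleteV-inducedBColoring⇒triangle G v φ m≤1+k (s≤s (s≤s (s≤s _)))
  with inducedBColoring-dense⇒clique (deleteV G v) φ m≤1+k
... | X , X-clique =
  punchIn v (X zero) , punchIn v (X (suc zero)) , punchIn v (X (suc (suc zero))) ,
  (punchInᵢ≢i v _ , punchInᵢ≢i v _ , punchInᵢ≢i v _) ,
  X-clique _ _ (λ ()) , X-clique _ _ (λ ()) , X-clique _ _ (λ ())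

module FiveVertices (G : Graph 5) (avoided : ∀ v → TriangleAvoiding G v) where

  private
    ~-sym : ∀ {u w} → Adj G u w → Adj G w u
    ~-sym = Adj-sym G

    ~⇒≢ : ∀ {u w} → Adj G u w → u ≢ w
    ~⇒≢ = Adj⇒≢ G

  six-distinct : ∀ {a b c d e f : Fin 5} → ¬ Unique (a ∷ b ∷ c ∷ d ∷ e ∷ f ∷ [])
  six-distinct = overfull⇒¬Unique ℕ.≤-refl

  hub : ∀ {y x₁ x₂ x₃ x₄} → Unique (x₁ ∷ x₂ ∷ x₃ ∷ x₄ ∷ []) →
    Adj G y x₁ → Adj G y x₂ → Adj G y x₃ → Adj G y x₄ → InducedHasBColoring G 4
  hub {y} unique y~x₁ y~x₂ y~x₃ y~x₄ = dominating⇒clique₄ G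
    (distinct-neighbours⇒dominating G unique refl (y~x₁ ∷ y~x₂ ∷ y~x₃ ∷ y~x₄ ∷ [])) (avoided y)

  OutsideNeighbour : Fin 5 → Fin 5 → Fin 5 → Set
  OutsideNeighbour x y z = ∃[ w ] ((w ≢ x × w ≢ y × w ≢ z) × Adj G w y × Adj G w z)

  module _ {x y z} (xy : Adj G x y) (xz : Adj G x z) (yz : Adj G y z) where

    InYZ : Fin 5 → Set
    InYZ u = u ≡ y ⊎ u ≡ z

    two-inside : ∀ {u u′ w} → InYZ u → InYZ u′ → Adj G u u′ → Adj G w u → Adj G w u′ → w ≢ x →
      OutsideNeighbour x y z
    two-inside (inj₁ refl) (inj₁ refl) uu′ _  _  _   = ⊥-elim (~⇒≢ uu′ refl)
    two-inside (inj₂ refl) (inj₂ refl) uu′ _  _  _   = ⊥-elim (~⇒≢ uu′ refl)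
    two-inside {w = w} (inj₁ refl) (inj₂ refl) _ wy wz w≢x = w , (w≢x , ~⇒≢ wy , ~⇒≢ wz) , wy , wz
    two-inside {w = w} (inj₂ refl) (inj₁ refl) _ wz wy w≢x = w , (w≢x , ~⇒≢ wy , ~⇒≢ wz) , wy , wz

    two-outside : ∀ {d e t} → (d ≢ x × d ≢ y × d ≢ z) → (e ≢ x × e ≢ y × e ≢ z) → t ≢ x →
      Adj G d e → Adj G d t → Adj G e t → InducedHasBColoring G 4
    two-outside {t = t} (d≢x , d≢y , d≢z) (e≢x , e≢y , e≢z) t≢x de dt et with t ≟ y | t ≟ z
    ... | yes refl | _ = hub
      ((~⇒≢ xz ∷ ≢-sym d≢x ∷ ≢-sym e≢x ∷ []) ∷ (≢-sym d≢z ∷ ≢-sym e≢z ∷ []) ∷ (~⇒≢ de ∷ []) ∷ [] ∷ [])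
      (~-sym xy) yz (~-sym dt) (~-sym et)
    ... | no _ | yes refl = hub
      ((~⇒≢ xy ∷ ≢-sym d≢x ∷ ≢-sym e≢x ∷ []) ∷ (≢-sym d≢y ∷ ≢-sym e≢y ∷ []) ∷ (~⇒≢ de ∷ []) ∷ [] ∷ [])
      (~-sym xz) (~-sym yz) (~-sym dt) (~-sym et)
    ... | no t≢y | no t≢z = ⊥-elim (six-distinct
      ((≢-sym (~⇒≢ dt) ∷ ≢-sym (~⇒≢ et) ∷ t≢x ∷ t≢y ∷ t≢z ∷ []) ∷
       (~⇒≢ de ∷ d≢x ∷ d≢y ∷ d≢z ∷ []) ∷ (e≢x ∷ e≢y ∷ e≢z ∷ []) ∷
       (~⇒≢ xy ∷ ~⇒≢ xz ∷ []) ∷ (~⇒≢ yz ∷ []) ∷ [] ∷ []))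

    InYZ? : ∀ u → Dec (InYZ u)
    InYZ? u = (u ≟ y) ⊎-dec (u ≟ z)

    outside : ∀ {u} → u ≢ x → ¬ InYZ u → u ≢ x × u ≢ y × u ≢ z
    outside u≢x u∉yz = u≢x , (λ u≡y → u∉yz (inj₁ u≡y)) , (λ u≡z → u∉yz (inj₂ u≡z))

    -- Look at a triangle avoiding x: either two of its vertices are y and z, or two lie outside xyz.
    triangle-step : InducedHasBColoring G 4 ⊎ OutsideNeighbour x y z
    triangle-step with avoided x
    ... | p , q , r , (p≢x , q≢x , r≢x) , pq , pr , qr with InYZ? p | InYZ? q | InYZ? r
    ... | yes p∈ | yes q∈ | _      = inj₂ (two-inside p∈ q∈ pq (~-sym pr) (~-sym qr) r≢x)
    ... | yes p∈ | no _   | yes r∈ = inj₂ (two-inside p∈ r∈ pr (~-sym pq) qr q≢x)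
    ... | no _   | yes q∈ | yes r∈ = inj₂ (two-inside q∈ r∈ qr pq pr p≢x)
    ... | no p∉  | no q∉  | _      = inj₁ (two-outside (outside p≢x p∉) (outside q≢x q∉) r≢x pq pr qr)
    ... | no p∉  | yes _  | no r∉  =
      inj₁ (two-outside (outside p≢x p∉) (outside r≢x r∉) q≢x pr pq (~-sym qr))
    ... | yes _  | no q∉  | no r∉  =
      inj₁ (two-outside (outside q≢x q∉) (outside r≢x r∉) p≢x qr (~-sym pq) (~-sym pr))

  -- Apply the step to each vertex of one triangle abc; three distinct outside neighbours
  -- would give six vertices.
  clique₄ : InducedHasBColoring G 4
  clique₄ with avoided zero
  ... | a , b , c , _ , ab , ac , bc
    with triangle-step ab ac bc | triangle-step (~-sym ab) bc ac | triangle-step (~-sym ac) (~-sym bc) ab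
  ... | inj₁ k₄ | _       | _       = k₄
  ... | _       | inj₁ k₄ | _       = k₄
  ... | _       | _       | inj₁ k₄ = k₄
  ... | inj₂ (wa , (wa≢a , wa≢b , wa≢c) , wa~b , wa~c)
      | inj₂ (wb , (wb≢b , wb≢a , wb≢c) , wb~a , wb~c)
      | inj₂ (wc , (wc≢c , wc≢a , wc≢b) , wc~a , wc~b)
    with wa ≟ wb | wa ≟ wc | wb ≟ wc
  ... | yes refl | _ | _ = clique₄⇒inducedBColoring G ab ac (~-sym wb~a) bc (~-sym wa~b) (~-sym wa~c)
  ... | _ | yes refl | _ = clique₄⇒inducedBColoring G ab ac (~-sym wc~a) bc (~-sym wa~b) (~-sym wa~c)
  ... | _ | _ | yes refl = clique₄⇒inducedBColoring G ab ac (~-sym wb~a) bc (~-sym wc~b) (~-sym wb~c)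
  ... | no wa≢wb | no wa≢wc | no wb≢wc = ⊥-elim (six-distinct
    ((~⇒≢ ab ∷ ~⇒≢ ac ∷ ≢-sym wa≢a ∷ ≢-sym wb≢a ∷ ≢-sym wc≢a ∷ []) ∷
     (~⇒≢ bc ∷ ≢-sym wa≢b ∷ ≢-sym wb≢b ∷ ≢-sym wc≢b ∷ []) ∷
     (≢-sym wa≢c ∷ ≢-sym wb≢c ∷ ≢-sym wc≢c ∷ []) ∷
     (wa≢wb ∷ wa≢wc ∷ []) ∷ (wb≢wc ∷ []) ∷ [] ∷ []))

invariant⇒bRelaxed-≤2 : ∀ {m b} (G : Graph (suc m)) → 4 ≤ suc m → suc m ≤ 5 →
  DeletionInvariant G → IsBRelaxed G b → b ≤ 2
invariant⇒bRelaxed-≤2 {3} G _ _ invariant Rb = invariant⇒bRelaxed-≤ G invariant Rb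
invariant⇒bRelaxed-≤2 {4} G _ _ invariant Rb with ℕ.m≤n⇒m<n∨m≡n (invariant⇒bRelaxed-≤ G invariant Rb)
... | inj₁ (s≤s b≤2) = b≤2
... | inj₂ refl = ⊥-elim (ℕ.n≮n 3 (proj₂ Rb 4 (FiveVertices.clique₄ G triangle-avoiding)))
  where
  triangle-avoiding : ∀ v → TriangleAvoiding G v
  triangle-avoiding v = decidable-stable (TriangleAvoiding? G v)
    (¬¬-map (λ φ → deleteV-inducedBColoring⇒triangle G v φ ℕ.≤-refl ℕ.≤-refl)
            (invariant-deleteV G invariant Rb v))
invariant⇒bRelaxed-≤2 {0} G (s≤s ()) _ _ _
invariant⇒bRelaxed-≤2 {1} G (s≤s (s≤s ())) _ _ _
invariant⇒bRelaxed-≤2 {2} G (s≤s (s≤s (s≤s ()))) _ _ _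
invariant⇒bRelaxed-≤2 {suc (suc (suc (suc (suc _))))} G _ (s≤s (s≤s (s≤s (s≤s (s≤s ()))))) _ _

edgeless⇒invariant : ∀ {m} (G : Graph (suc (suc m))) → Edgeless G → DeletionInvariant G
edgeless⇒invariant G edgeless v a b Ra Rb =
  trans (edgeless⇒bRelaxed≡1 (deleteV G v) (λ _ _ → edgeless _ _) zero Ra)
        (sym (edgeless⇒bRelaxed≡1 G edgeless zero Rb))

disjointEdges⇒invariant : ∀ {m} (G : Graph (suc m)) → suc m ≤ 5 → TwoDisjointEdges G →
  ¬ ContainsInducedBAtom G 3 → DeletionInvariant G
disjointEdges⇒invariant G n≤5 (p , q , r , s , pq , rs , p≢r , p≢s , q≢r , q≢s) ¬atom v a b Ra Rb =
  trans (bRelaxed-≡ (deleteV G v) Ra deleteV-edge (λ j φ → ≤2 j (inducedBColoring-deleteV G v φ)))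
        (sym (bRelaxed-≡ G Rb (edge⇒inducedBColoring G pq) ≤2))
  where
  ≤2 = ¬bAtom⇒inducedBColoring-≤2 G n≤5 ¬atom
  -- v lies on at most one of the two disjoint edges.
  deleteV-edge : InducedHasBColoring (deleteV G v) 2
  deleteV-edge with v ≟ p | v ≟ q
  ... | yes refl | _        = edge⇒inducedBColoring (deleteV G v) (Adj⇒Adj-deleteV G p≢r p≢s rs)
  ... | no _     | yes refl = edge⇒inducedBColoring (deleteV G v) (Adj⇒Adj-deleteV G q≢r q≢s rs)
  ... | no v≢p   | no v≢q   = edge⇒inducedBColoring (deleteV G v) (Adj⇒Adj-deleteV G v≢p v≢q pq)

DeletionTight : ∀ m → Graph (suc m) → Set
DeletionTight m G = ∀ v a b → IsBRelaxed (deleteV G v) a → IsBRelaxed G b → a + 2 ≡ b + suc m / 2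

TightFamily : ∀ m → Graph (suc m) → Set
TightFamily m G = (IsP2 G ⊎ IsC3 G)
  ⊎ (Edgeless G × 4 ≤ suc m × suc m ≤ 5)
  ⊎ (4 ≤ suc m × suc m ≤ 5 × TwoDisjointEdges G × ¬ ContainsInducedBAtom G 3)

half≡2 : ∀ {m} → 4 ≤ suc m → suc m ≤ 5 → suc m / 2 ≡ 2
half≡2 {3} _ _ = refl
half≡2 {4} _ _ = refl
half≡2 {0} (s≤s ()) _
half≡2 {1} (s≤s (s≤s ())) _
half≡2 {2} (s≤s (s≤s (s≤s ()))) _
half≡2 {suc (suc (suc (suc (suc _))))} _ (s≤s (s≤s (s≤s (s≤s (s≤s ())))))

tight⇒invariant : ∀ {m} (G : Graph (suc m)) → suc m / 2 ≡ 2 → DeletionTight m G → DeletionInvariant G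
tight⇒invariant G half tight v a b Ra Rb = ℕ.+-cancelʳ-≡ 2 a b (trans (tight v a b Ra Rb) (cong (b +_) half))

invariant⇒tight : ∀ {m} (G : Graph (suc m)) → suc m / 2 ≡ 2 → DeletionInvariant G → DeletionTight m G
invariant⇒tight G half invariant v a b Ra Rb = trans (cong (_+ 2) (invariant v a b Ra Rb)) (cong (b +_) (sym half))

complete⇒tight : ∀ {m} (G : Graph (suc m)) → suc m / 2 ≡ 1 → Complete G → DeletionTight m G
complete⇒tight {m} G half complete v a b Ra Rb
  rewrite complete⇒bRelaxed≡ (deleteV G v) (deleteV-complete G v complete) Ra
        | complete⇒bRelaxed≡ G complete Rb | half = ℕ.+-suc m 1

+2≡+1⇒suc≡ : ∀ a b → a + 2 ≡ b + 1 → suc a ≡ b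
+2≡+1⇒suc≡ a b e = ℕ.+-cancelʳ-≡ 1 (suc a) b (trans (sym (ℕ.+-suc a 1)) e)

single-vertex-¬tight : (G : Graph 1) → ¬ DeletionTight 0 G
single-vertex-¬tight G tight
  with tight zero 0 1 (bRelaxed-full (deleteV G zero) (allPairs⇒inducedBColoring (deleteV G zero) []))
                      (bRelaxed-full G (vertex⇒inducedBColoring G zero))
... | ()

two-vertex-tight⇒complete : (G : Graph 2) → DeletionTight 1 G → Complete G
two-vertex-tight⇒complete G tight = Complete-stable G λ ¬complete →
  ¬¬-bRelaxed G λ { (b , Rb) → ¬¬-bRelaxed (deleteV G zero) λ { (a , Ra) →
  ¬complete (bRelaxed-≥⇒complete G Rb (subst (2 ≤_) (+2≡+1⇒suc≡ a b (tight zero a b Ra Rb))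
    (s≤s (proj₂ Ra 1 (vertex⇒inducedBColoring (deleteV G zero) zero))))) } }

-- φ_r(G - 0) ≥ 1 forces an edge uw, and then φ_r(G - v) ≥ 2 for the third vertex v.
three-vertex-tight⇒complete : (G : Graph 3) → DeletionTight 2 G → Complete G
three-vertex-tight⇒complete G tight = Complete-stable G λ ¬complete →
  ¬¬-bRelaxed G λ { (b , Rb) → ¬¬-bRelaxed (deleteV G zero) λ { (a₀ , Ra₀) →
  let 2≤b = subst (2 ≤_) (+2≡+1⇒suc≡ a₀ b (tight zero a₀ b Ra₀ Rb))
              (s≤s (proj₂ Ra₀ 1 (vertex⇒inducedBColoring (deleteV G zero) zero)))
      (u , w , uw) = inducedBColoring⇒edge G (proj₁ Rb) 2≤b
      (v , v≢u , v≢w) = third-vertex (Adj⇒≢ G uw)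
  in ¬¬-bRelaxed (deleteV G v) λ { (a , Ra) →
  ¬complete (bRelaxed-≥⇒complete G Rb (subst (3 ≤_) (+2≡+1⇒suc≡ a b (tight v a b Ra Rb))
    (s≤s (proj₂ Ra 2 (edge⇒inducedBColoring (deleteV G v) (Adj⇒Adj-deleteV G v≢u v≢w uw)))))) } } }

large-¬tight : ∀ {k} (G : Graph (6 + k)) → ¬ DeletionTight (5 + k) G
large-¬tight {k} G tight = ¬¬-bRelaxed G λ { (b , Rb) → ¬¬-bRelaxed (deleteV G zero) λ { (a , Ra) →
  ℕ.<-irrefl (tight zero a b Ra Rb)
    (ℕ.+-mono-≤-< (bRelaxed-deleteV-≤ G zero Ra Rb) (/-monoˡ-≤ 2 (ℕ.m≤m+n 6 k))) } }

invariant⇒family : ∀ {m} (G : Graph (suc m)) → 4 ≤ suc m → suc m ≤ 5 → DeletionInvariant G →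
  TightFamily m G
invariant⇒family G 4≤n n≤5 invariant with Edge? G
... | no ¬edge = inj₂ (inj₁ (¬Edge⇒Edgeless G ¬edge , 4≤n , n≤5))
... | yes (_ , _ , uw) with TwoDisjointEdges? G
...   | no ¬disjoint = ⊥-elim (edge⇒¬invariant G ¬disjoint uw invariant)
...   | yes disjoint = inj₂ (inj₂ (4≤n , n≤5 , disjoint ,
        bRelaxed-≤2⇒¬bAtom G (invariant⇒bRelaxed-≤2 G 4≤n n≤5 invariant)))

tight⇒family : ∀ m (G : Graph (suc m)) → DeletionTight m G → TightFamily m G
tight⇒family 0 G tight = ⊥-elim (single-vertex-¬tight G tight)
tight⇒family 1 G tight = inj₁ (inj₁ (refl , two-vertex-tight⇒complete G tight))
tight⇒family 2 G tight = inj₁ (inj₂ (refl , three-vertex-tight⇒complete G tight))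
tight⇒family 3 G tight = invariant⇒family G ℕ.≤-refl (ℕ.n≤1+n 4) (tight⇒invariant G refl tight)
tight⇒family 4 G tight = invariant⇒family G (ℕ.n≤1+n 4) ℕ.≤-refl (tight⇒invariant G refl tight)
tight⇒family (suc (suc (suc (suc (suc _))))) G tight = ⊥-elim (large-¬tight G tight)

family⇒tight : ∀ m (G : Graph (suc m)) → TightFamily m G → DeletionTight m G
family⇒tight _ G (inj₁ (inj₁ (refl , complete))) = complete⇒tight G refl complete
family⇒tight _ G (inj₁ (inj₂ (refl , complete))) = complete⇒tight G refl complete
family⇒tight zero G (inj₂ (inj₁ (_ , s≤s () , _)))
family⇒tight (suc _) G (inj₂ (inj₁ (edgeless , 4≤n , n≤5))) =
  invariant⇒tight G (half≡2 4≤n n≤5) (edgeless⇒invariant G edgeless)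
family⇒tight _ G (inj₂ (inj₂ (4≤n , n≤5 , disjoint , ¬atom))) =
  invariant⇒tight G (half≡2 4≤n n≤5) (disjointEdges⇒invariant G n≤5 disjoint ¬atom)

mainTheorem8 : ∀ (m : ℕ) (G : Graph (suc m)) →
    (∀ (v : Fin (suc m)) (a b : ℕ) → IsBRelaxed (deleteV G v) a → IsBRelaxed G b →
        a + 2 ≡ b + suc m / 2)
    ⇔ ((IsP2 G ⊎ IsC3 G)
      ⊎ (Edgeless G × 4 ≤ suc m × suc m ≤ 5)
      ⊎ (4 ≤ suc m × suc m ≤ 5 × TwoDisjointEdges G × ¬ ContainsInducedBAtom G 3))
mainTheorem8 m G = mk⇔ (tight⇒family m G) (family⇒tight m G)
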